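{- Let $G$ be a finite directed graph which is connected, has no circuit and has no transitivity edge (no edge $(u,v)$ with also a chain of length at least $2$ from $u$ to $v$). Let $c$ be a chain of $G$ with vertex set $V_c$, and let $\overline{G_1},\dots,\overline{G_k}$ be the corresponding regions (the subgraphs of $G$ induced on $V(G_j)\cup V_c$, where $G_1,\dots,G_k$ are the connected components of the subgraph induced on $V_G\setminus V_c$). If $\overline{G_1}$ is not a tree, then there exists a cycle $C$ in $\overline{G_1}$ such that $HE(C)$ contains no edge of $c$.
   Context: A graph $G$ has finite vertex set $V_G$ and edge set $E_G\subset V_G\times V_G$; for $e=(u,v)$, $\alpha(e)=u$, $\omega(e)=v$, $\overline e=(v,u)$. A chain is a sequence of edges $(e_1,\dots,e_k)$ with $\omega(e_i)=\alpha(e_{i+1})$ for $i<k$, all edges and vertices distinct; a circuit is a chain with $\omega(e_k)=\alpha(e_1)$. A cycle is a sequence $(e_1,\dots,e_k)$ of elements of $E_G\cup\{\overline e:e\in E_G\}$ with $\omega(e_i)=\alpha(e_{i+1})$ for $i<k$, $\omega(e_k)=\alpha(e_1)$, all $e_i$ distinct and all visited vertices distinct; $HE(C)$ is the set of those $e_i$ belonging to $E_G$ (edges traversed in their own direction). A tree is a connected graph whose underlying undirected graph has no cycle. Induced subgraphs contain all edges of $G$ with both endpoints in the given vertex set. -}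

module Defs where

open import Level using (0ℓ)
open import Data.Nat using (ℕ; _≥_)
open import Data.Bool using (Bool; true)
open import Data.Fin using (Fin)
open import Data.Product using (_×_; _,_; proj₁; proj₂; Σ; ∃)
open import Data.Sum using (_⊎_)
open import Data.Unit using (⊤)
open import Data.List using (List; []; _∷_; map; length)
open import Data.List.Membership.Propositional using () renaming (_∈_ to _∈ₗ_)
open import Data.List.Relation.Unary.Unique.Propositional using (Unique)
open import Data.List.Relation.Unary.AllPairs using (AllPairs)
open import Relation.Binary.PropositionalEquality using (_≡_; _≢_)
open import Relation.Nullary using (¬_)
open import Relation.Unary using (Pred; _∈_; _⊆_; _∪_; Satisfiable)

record Graph : Set where
  constructor mkGraph
  field
    n : ℕ
    E : Fin n → Fin n → Bool
open Graph public

V : Graph → Set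
V G = Fin (n G)

-- elements of V_G × V_G (edges, or reversed edges)
Arc : Graph → Set
Arc G = V G × V G

flip : ∀ {G} → Arc G → Arc G
flip (u , v) = (v , u)

IsEdge : (G : Graph) → Arc G → Set
IsEdge G (u , v) = E G u v ≡ true

IsEdgeOrRev : (G : Graph) → Arc G → Set
IsEdgeOrRev G e = IsEdge G e ⊎ IsEdge G (flip {G} e)

data Seq (G : Graph) (OK : Arc G → Set) : V G → V G → List (Arc G) → Set where
  nil  : ∀ {u} → Seq G OK u u []
  cons : ∀ {u v w es} → OK (u , v) → Seq G OK v w es → Seq G OK u w ((u , v) ∷ es)

chainVertices : ∀ {G} → List (Arc G) → List (V G)
chainVertices [] = []
chainVertices (e ∷ es) = proj₁ e ∷ map proj₂ (e ∷ es)

IsChainFromTo : (G : Graph) → V G → V G → List (Arc G) → Set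
IsChainFromTo G u v es =
  Seq G (IsEdge G) u v es × Unique es × Unique (chainVertices {G} es)

IsChain : (G : Graph) → List (Arc G) → Set
IsChain G es = ∃ λ u → ∃ λ v → IsChainFromTo G u v es

-- circuit: a chain closing up (ω(e_k) = α(e_1)); distinct vertices are α(e_1),…,α(e_k)
IsCircuit : (G : Graph) → List (Arc G) → Set
IsCircuit G es = ∃ λ u →
  Seq G (IsEdge G) u u es × length es ≥ 1 × Unique es × Unique (map proj₁ es)

DistinctEdge : ∀ {G} → Arc G → Arc G → Set
DistinctEdge {G} e f = e ≢ f × e ≢ flip {G} f

IsCycle : (G : Graph) → List (Arc G) → Set
IsCycle G es = ∃ λ u →
  Seq G (IsEdgeOrRev G) u u es × length es ≥ 1
  × AllPairs (DistinctEdge {G}) es × Unique (map proj₁ es)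

HEAvoids : (G : Graph) → List (Arc G) → List (Arc G) → Set
HEAvoids G C c = ∀ e → e ∈ₗ C → IsEdge G e → ¬ (e ∈ₗ c)

NoTransitivityEdge : Graph → Set
NoTransitivityEdge G = ∀ u v → IsEdge G (u , v) →
  ¬ (∃ λ es → IsChainFromTo G u v es × length es ≥ 2)

NoCircuit : Graph → Set
NoCircuit G = ∀ es → ¬ IsCircuit G es

data ReachIn (G : Graph) (R : Pred (V G) 0ℓ) : V G → V G → Set where
  here : ∀ {u} → ReachIn G R u u
  step : ∀ {u v w} → IsEdgeOrRev G (u , v) → v ∈ R → ReachIn G R v w → ReachIn G R u w

ConnectedOn : (G : Graph) → Pred (V G) 0ℓ → Set
ConnectedOn G R = ∀ u v → u ∈ R → v ∈ R → ReachIn G R u v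

Connected : Graph → Set
Connected G = ConnectedOn G (λ _ → ⊤)

IsComponent : (G : Graph) → Pred (V G) 0ℓ → Pred (V G) 0ℓ → Set₁
IsComponent G T K =
  K ⊆ T × Satisfiable K × ConnectedOn G K
  × (∀ (L : Pred (V G) 0ℓ) → L ⊆ T → K ⊆ L → ConnectedOn G L → L ⊆ K)

IsCycleIn : (G : Graph) → Pred (V G) 0ℓ → List (Arc G) → Set
IsCycleIn G R es = IsCycle G es × (∀ e → e ∈ₗ es → (proj₁ e ∈ R × proj₂ e ∈ R))

IsTreeOn : (G : Graph) → Pred (V G) 0ℓ → Set
IsTreeOn G R = ConnectedOn G R × ¬ (∃ λ es → IsCycleIn G R es)

Vc : (G : Graph) → List (Arc G) → Pred (V G) 0ℓ
Vc G c v = v ∈ₗ chainVertices {G} c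

NotVc : (G : Graph) → List (Arc G) → Pred (V G) 0ℓ
NotVc G c v = ¬ (v ∈ₗ chainVertices {G} c)

Region : (G : Graph) → List (Arc G) → Pred (V G) 0ℓ → Pred (V G) 0ℓ
Region G c K = K ∪ Vc G c

module Submission where

-- R is connected, and whether it contains a cycle is decidable (a
-- cycle has at most |V_G| arcs), so R contains some cycle C.  If no forward
-- arc of C lies on c we are done.  Otherwise C passes through an arc (p, q)
-- of c.  Because G has no circuit and no transitivity edge, the only edges
-- between chain vertices are the arcs of c, so walking along c away from
-- the arc, the last vertices x (behind p) and y (beyond q) still on C must
-- have a C-neighbour in K.  Then x ≠ y, and the cycle that goes from y back
-- along c to x, over to K, through K and back to y is the required one:
-- its chain arcs are all traversed backwards.

open import Defs
open import Data.Nat using (zero; suc; _+_; _≤_; z≤n; s≤s; _≥?_)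
import Data.Nat.Properties as ℕ
open import Data.Bool using (true)
import Data.Bool.Properties as Bool
import Data.Fin.Properties as Fin
open import Data.Product using (Σ; ∃; ∃₂; _×_; _,_; proj₁; proj₂; uncurry)
open import Data.Product.Properties using () renaming (≡-dec to ×-≡-dec)
open import Data.Sum using (_⊎_; inj₁; inj₂)
open import Data.Empty using (⊥; ⊥-elim)
open import Data.Unit using (⊤; tt)
open import Data.List using (List; []; _∷_; _++_; [_]; map; reverse; length)
open import Data.List.Properties using (map-++; ++-assoc; length-++; length-map; length-tabulate; reverse-++; unfold-reverse; ∷ʳ-injective; ∷-injective)
open import Data.List.Relation.Unary.All as All using (All; []; _∷_)
import Data.List.Relation.Unary.All.Properties as All
open import Data.List.Relation.Unary.Any using (here; there; any?)
import Data.List.Relation.Unary.Any.Properties as Any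
open import Data.List.Relation.Unary.AllPairs using (AllPairs; []; _∷_; allPairs?) renaming (map to AllPairs-map)
import Data.List.Relation.Unary.AllPairs.Properties as AllPairs
open import Data.List.Relation.Unary.Unique.Propositional using (Unique)
import Data.List.Relation.Unary.Unique.Propositional.Properties as Unique
open import Data.List.Membership.Propositional using (_∈_; _∉_; find; lose)
open import Data.List.Membership.Propositional.Properties using (∈-map⁺; ∈-map⁻; ∈-∃++; ∈-++⁻; ∈-++⁺ˡ; ∈-++⁺ʳ; ∈-allFin)
open import Relation.Binary.PropositionalEquality using (_≡_; _≢_; refl; sym; trans; cong; subst; module ≡-Reasoning)
open import Function using (_∘_)
open import Relation.Nullary using (Dec; yes; no; ¬_; ¬?)
open import Relation.Nullary.Decidable using (map′; _×-dec_; _⊎-dec_)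

-- Facts about duplicate-free lists.

module _ {A : Set} where

  Unique-++⁻ : ∀ xs {ys : List A} → Unique (xs ++ ys) →
               Unique xs × Unique ys × (∀ {x y} → x ∈ xs → y ∈ ys → x ≢ y)
  Unique-++⁻ [] u = [] , u , λ ()
  Unique-++⁻ (x ∷ xs) (x∉ ∷ u) with Unique-++⁻ xs u
  ... | uxs , uys , disj = All.++⁻ˡ xs x∉ ∷ uxs , uys , apart
    where
      apart : ∀ {a b} → a ∈ x ∷ xs → b ∈ _ → a ≢ b
      apart (here refl) b∈ = All.lookup (All.++⁻ʳ xs x∉) b∈
      apart (there a∈) b∈ = disj a∈ b∈

  Unique-∷ : ∀ {x : A} {xs} → x ∉ xs → Unique xs → Unique (x ∷ xs)
  Unique-∷ x∉ u = All.tabulate (λ { m refl → x∉ m }) ∷ u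

  Unique-++⁺ : ∀ {xs ys : List A} → Unique xs → Unique ys → (∀ {x} → x ∈ xs → x ∈ ys → ⊥) → Unique (xs ++ ys)
  Unique-++⁺ uxs uys disj = Unique.++⁺ uxs uys (uncurry disj)

  Unique-reverse : ∀ (xs : List A) → Unique xs → Unique (reverse xs)
  Unique-reverse [] u = []
  Unique-reverse (x ∷ xs) (x∉ ∷ u) rewrite unfold-reverse x xs =
    Unique-++⁺ (Unique-reverse xs u) ([] ∷ [])
      (λ { m (here refl) → All.lookup x∉ (Any.reverse⁻ m) refl })

  ∈-remove : ∀ {x y : A} ys₁ {ys₂} → y ∈ ys₁ ++ x ∷ ys₂ → y ≢ x → y ∈ ys₁ ++ ys₂
  ∈-remove [] (here refl) y≢x = ⊥-elim (y≢x refl)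
  ∈-remove [] (there m) y≢x = m
  ∈-remove (z ∷ ys₁) (here refl) y≢x = here refl
  ∈-remove (z ∷ ys₁) (there m) y≢x = there (∈-remove ys₁ m y≢x)

  Unique-length : ∀ {xs ys : List A} → Unique xs → (∀ {x} → x ∈ xs → x ∈ ys) → length xs ≤ length ys
  Unique-length {[]} u sub = z≤n
  Unique-length {x ∷ xs} (x∉ ∷ u) sub with ∈-∃++ (sub (here refl))
  ... | ys₁ , ys₂ , refl = begin
      suc (length xs)                ≤⟨ s≤s (Unique-length u (λ m → ∈-remove ys₁ (sub (there m)) (λ eq → All.lookup x∉ m (sym eq)))) ⟩
      suc (length (ys₁ ++ ys₂))      ≡⟨ cong suc (length-++ ys₁) ⟩
      suc (length ys₁ + length ys₂) ≡⟨ sym (ℕ.+-suc (length ys₁) _) ⟩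
      length ys₁ + length (x ∷ ys₂) ≡⟨ sym (length-++ ys₁) ⟩
      length (ys₁ ++ x ∷ ys₂)        ∎
    where open ℕ.≤-Reasoning

  AllPairs-either : ∀ {R : A → A → Set} {xs a b} → AllPairs R xs → a ∈ xs → b ∈ xs → a ≢ b → R a b ⊎ R b a
  AllPairs-either (_ ∷ _) (here refl) (here refl) a≢b = ⊥-elim (a≢b refl)
  AllPairs-either (ra ∷ _) (here refl) (there b∈) _ = inj₁ (All.lookup ra b∈)
  AllPairs-either (rb ∷ _) (there a∈) (here refl) _ = inj₂ (All.lookup rb a∈)
  AllPairs-either (_ ∷ rs) (there a∈) (there b∈) a≢b = AllPairs-either rs a∈ b∈ a≢b

  Adjacent : List A → A → A → Set
  Adjacent xs a b = ∃₂ λ pre suf → xs ≡ pre ++ a ∷ b ∷ suf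

  Neighbours : List A → A → A → Set
  Neighbours xs a b = Adjacent xs a b ⊎ Adjacent xs b a

  split-unique : ∀ {y : A} as bs as′ bs′ → Unique (as ++ y ∷ bs) → as ++ y ∷ bs ≡ as′ ++ y ∷ bs′ → as ≡ as′ × bs ≡ bs′
  split-unique [] bs [] bs′ U refl = refl , refl
  split-unique [] bs (z ∷ as′) bs′ (y∉ ∷ _) refl = ⊥-elim (All.lookup y∉ (∈-++⁺ʳ as′ (here refl)) refl)
  split-unique (z ∷ as) bs [] bs′ (y∉ ∷ _) refl = ⊥-elim (All.lookup y∉ (∈-++⁺ʳ as (here refl)) refl)
  split-unique (z ∷ as) bs (z′ ∷ as′) bs′ (_ ∷ U) eq with ∷-injective eq
  ... | refl , eq′ with split-unique as bs as′ bs′ U eq′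
  ... | refl , refl = refl , refl

  neighbour-position : ∀ {xs y r} as bs → Unique xs → xs ≡ as ++ y ∷ bs → Neighbours xs y r →
                       (∃ λ as′ → as ≡ as′ ++ [ r ]) ⊎ (∃ λ bs′ → bs ≡ r ∷ bs′)
  neighbour-position as bs U refl (inj₁ (pre , suf , eq)) = inj₂ (suf , proj₂ (split-unique as bs pre _ U eq))
  neighbour-position {r = r} as bs U refl (inj₂ (pre , suf , eq)) =
    inj₁ (pre , proj₁ (split-unique as bs (pre ++ [ r ]) suf U (trans eq (sym (++-assoc pre [ r ] _)))))

  reverse-adjacent : ∀ (pre : List A) a b suf → reverse (pre ++ a ∷ b ∷ suf) ≡ (reverse suf ++ [ b ]) ++ a ∷ reverse pre
  reverse-adjacent pre a b suf = begin
    reverse (pre ++ a ∷ b ∷ suf)                  ≡⟨ reverse-++ pre (a ∷ b ∷ suf) ⟩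
    reverse (a ∷ b ∷ suf) ++ reverse pre          ≡⟨ cong (_++ reverse pre) (unfold-reverse a (b ∷ suf)) ⟩
    (reverse (b ∷ suf) ++ [ a ]) ++ reverse pre   ≡⟨ ++-assoc (reverse (b ∷ suf)) [ a ] (reverse pre) ⟩
    reverse (b ∷ suf) ++ a ∷ reverse pre          ≡⟨ cong (_++ a ∷ reverse pre) (unfold-reverse b suf) ⟩
    (reverse suf ++ [ b ]) ++ a ∷ reverse pre     ∎
    where open ≡-Reasoning

  Neighbours-reverse : ∀ {xs a b} → Neighbours xs a b → Neighbours (reverse xs) a b
  Neighbours-reverse (inj₁ (pre , suf , refl)) =
    inj₂ (reverse suf , reverse pre , trans (reverse-adjacent pre _ _ suf) (++-assoc (reverse suf) _ _))
  Neighbours-reverse (inj₂ (pre , suf , refl)) =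
    inj₁ (reverse suf , reverse pre , trans (reverse-adjacent pre _ _ suf) (++-assoc (reverse suf) _ _))

  -- The last element of the maximal run of P-elements of xs that starts at
  -- a given occurrence.
  record RunEnd (P : A → Set) (xs from : List A) : Set where
    field
      before : List A
      last   : A
      after  : List A
      split  : xs ≡ before ++ last ∷ after
      inRun  : P last
      within : last ∈ from
      stops  : ∀ {r rest} → after ≡ r ∷ rest → ¬ P r

  runEnd : ∀ {P : A → Set} → (∀ x → Dec (P x)) → ∀ {xs} as z bs → xs ≡ as ++ z ∷ bs → P z → RunEnd P xs (z ∷ bs)
  runEnd P? as z [] eq pz = record { split = eq ; inRun = pz ; within = here refl ; stops = λ () }
  runEnd P? as z (r ∷ bs) eq pz with P? r
  ... | no ¬pr = record { split = eq ; inRun = pz ; within = here refl ; stops = λ { refl → ¬pr } }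
  ... | yes pr = record { RunEnd run ; within = there (RunEnd.within run) }
    where run = runEnd P? (as ++ [ z ]) r bs (trans eq (sym (++-assoc as [ z ] (r ∷ bs)))) pr

Searchable : Set → Set₁
Searchable A = ∀ {P : A → Set} → (∀ a → Dec (P a)) → Dec (∃ P)

searchLists : ∀ {A} → Searchable A → ∀ k {P : List A → Set} → (∀ xs → Dec (P xs)) →
              Dec (∃ λ xs → length xs ≤ k × P xs)
searchLists search zero P? = map′ (λ p → [] , z≤n , p) (λ { ([] , _ , p) → p ; (_ ∷ _ , () , _) }) (P? [])
searchLists search (suc k) {P} P? =
  map′ join split (P? [] ⊎-dec search (λ a → searchLists search k (λ xs → P? (a ∷ xs))))
  where
    join : P [] ⊎ ∃ (λ a → ∃ λ xs → length xs ≤ k × P (a ∷ xs)) → ∃ λ xs → length xs ≤ suc k × P xs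
    join (inj₁ p) = [] , z≤n , p
    join (inj₂ (a , xs , le , p)) = a ∷ xs , s≤s le , p
    split : (∃ λ xs → length xs ≤ suc k × P xs) → P [] ⊎ ∃ (λ a → ∃ λ xs → length xs ≤ k × P (a ∷ xs))
    split ([] , _ , p) = inj₁ p
    split (a ∷ xs , s≤s le , p) = inj₂ (a , xs , le , p)

-- Walks, reachability and cycles in a finite graph.

module GraphFacts (G : Graph) where

  searchVertex : Searchable (V G)
  searchVertex = Fin.any?

  searchArc : Searchable (Arc G)
  searchArc P? = map′ (λ { (u , v , p) → (u , v) , p }) (λ { ((u , v) , p) → u , v , p })
                      (Fin.any? λ u → Fin.any? λ v → P? (u , v))

  _≟ₐ_ : ∀ (e f : Arc G) → Dec (e ≡ f)
  _≟ₐ_ = ×-≡-dec Fin._≟_ Fin._≟_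

  edge? : ∀ a → Dec (IsEdge G a)
  edge? (u , v) = E G u v Bool.≟ true

  edgeOrRev? : ∀ a → Dec (IsEdgeOrRev G a)
  edgeOrRev? (u , v) = edge? (u , v) ⊎-dec edge? (v , u)

  edgeOrRev-flip : ∀ {u v} → IsEdgeOrRev G (u , v) → IsEdgeOrRev G (v , u)
  edgeOrRev-flip (inj₁ e) = inj₂ e
  edgeOrRev-flip (inj₂ e) = inj₁ e

  Unique-bound : ∀ (xs : List (V G)) → Unique xs → length xs ≤ n G
  Unique-bound xs u = subst (length xs ≤_) (length-tabulate (λ i → i)) (Unique-length u (λ {x} _ → ∈-allFin x))

  visits : V G → List (Arc G) → List (V G)
  visits u es = u ∷ map proj₂ es

  module _ {OK : Arc G → Set} where

    seq-++ : ∀ {u v w as bs} → Seq G OK u v as → Seq G OK v w bs → Seq G OK u w (as ++ bs)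
    seq-++ nil s = s
    seq-++ (cons o r) s = cons o (seq-++ r s)

    seq-split : ∀ {u w} as {bs} → Seq G OK u w (as ++ bs) → ∃ λ v → Seq G OK u v as × Seq G OK v w bs
    seq-split [] s = _ , nil , s
    seq-split (_ ∷ as) (cons o s) with seq-split as s
    ... | v , s₁ , s₂ = v , cons o s₁ , s₂

    seq-arc : ∀ {u w es e} → Seq G OK u w es → e ∈ es → OK e
    seq-arc (cons o s) (here refl) = o
    seq-arc (cons o s) (there m) = seq-arc s m

    seq-target : ∀ {u w e es} → Seq G OK u w (e ∷ es) → w ∈ map proj₂ (e ∷ es)
    seq-target (cons o nil) = here refl
    seq-target (cons o (cons o′ s)) = there (seq-target (cons o′ s))

    seq-visits : ∀ {u w es} → Seq G OK u w es → visits u es ≡ map proj₁ es ++ [ w ]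
    seq-visits nil = refl
    seq-visits (cons o s) = cong (_ ∷_) (seq-visits s)

    seq-endpoints : ∀ {u w es a b} → Seq G OK u w es → (a , b) ∈ es → a ∈ visits u es × b ∈ map proj₂ es
    seq-endpoints (cons o s) (here refl) = here refl , here refl
    seq-endpoints (cons o s) (there m) with seq-endpoints s m
    ... | a∈ , b∈ = there a∈ , there b∈

    seq-cut : ∀ {u w es x} → Seq G OK u w es → x ∈ visits u es →
              ∃₂ λ as bs → es ≡ as ++ bs × Seq G OK u x as × Seq G OK x w bs
    seq-cut s (here refl) = [] , _ , refl , nil , s
    seq-cut (cons o s) (there m) with seq-cut s m
    ... | as , bs , refl , s₁ , s₂ = _ ∷ as , bs , refl , cons o s₁ , s₂

    unique-prefix : ∀ {u} as {bs} → Unique (visits u (as ++ bs)) → Unique (visits u as)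
    unique-prefix {u} as {bs} U rewrite map-++ proj₂ as bs = proj₁ (Unique-++⁻ (u ∷ map proj₂ as) U)

    unique-suffix : ∀ {u v w} as {bs} → Seq G OK u v as → Seq G OK v w bs →
                    Unique (visits u (as ++ bs)) → Unique (visits v bs)
    unique-suffix [] nil s₂ U = U
    unique-suffix (e ∷ as) {bs} s₁ s₂ (_ ∷ U) rewrite map-++ proj₂ (e ∷ as) bs with Unique-++⁻ (map proj₂ (e ∷ as)) U
    ... | _ , U₂ , apart = Unique-∷ (λ m → apart (seq-target s₁) m refl) U₂

    simple-distinct : ∀ {u w es} → Seq G OK u w es → Unique (visits u es) → AllPairs (DistinctEdge {G}) es
    simple-distinct nil U = []
    simple-distinct (cons {v = v} o s) (u∉ ∷ U) =
      All.tabulate (λ m → let a∈ , b∈ = seq-endpoints s m in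
                     (λ eq → All.lookup u∉ (subst (_∈ _) (sym (cong proj₁ eq)) a∈) refl) ,
                     (λ eq → All.lookup u∉ (there (subst (_∈ _) (sym (cong proj₁ eq)) b∈)) refl))
      ∷ simple-distinct s U

  seq-map : ∀ {OK OK′ : Arc G → Set} → (∀ {e} → OK e → OK′ e) → ∀ {u w es} → Seq G OK u w es → Seq G OK′ u w es
  seq-map f nil = nil
  seq-map f (cons o s) = cons (f o) (seq-map f s)

  seq? : ∀ {OK : Arc G → Set} → (∀ a → Dec (OK a)) → ∀ u w es → Dec (Seq G OK u w es)
  seq? OK? u w [] with u Fin.≟ w
  ... | yes refl = yes nil
  ... | no u≢w = no λ { nil → u≢w refl }
  seq? OK? u w ((x , y) ∷ es) with u Fin.≟ x
  ... | no u≢x = no λ { (cons _ _) → u≢x refl }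
  ... | yes refl = map′ (uncurry cons) (λ { (cons o s) → o , s }) (OK? (u , y) ×-dec seq? OK? y w es)

  reversePath : List (Arc G) → List (Arc G)
  reversePath [] = []
  reversePath (e ∷ es) = reversePath es ++ [ flip {G} e ]

  seq-reversePath : ∀ {u w es} → Seq G (IsEdge G) u w es → Seq G (IsEdgeOrRev G) w u (reversePath es)
  seq-reversePath nil = nil
  seq-reversePath (cons o s) = seq-++ (seq-reversePath s) (cons (inj₂ o) nil)

  reversePath-∈ : ∀ {e} es → e ∈ reversePath es → flip {G} e ∈ es
  reversePath-∈ (x ∷ es) m with ∈-++⁻ (reversePath es) m
  ... | inj₁ m′ = there (reversePath-∈ es m′)
  ... | inj₂ (here refl) = here refl

  reversePath-targets : ∀ es → map proj₂ (reversePath es) ≡ reverse (map proj₁ es)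
  reversePath-targets [] = refl
  reversePath-targets (e ∷ es) = begin
    map proj₂ (reversePath es ++ [ flip {G} e ]) ≡⟨ map-++ proj₂ (reversePath es) _ ⟩
    map proj₂ (reversePath es) ++ [ proj₁ e ]    ≡⟨ cong (_++ _) (reversePath-targets es) ⟩
    reverse (map proj₁ es) ++ [ proj₁ e ]        ≡⟨ sym (unfold-reverse _ (map proj₁ es)) ⟩
    reverse (proj₁ e ∷ map proj₁ es)             ∎
    where open ≡-Reasoning

  closeCycle : ∀ {u w es} → Seq G (IsEdgeOrRev G) u w es → Unique (visits u es) →
               (u , w) ∉ es → IsEdgeOrRev G (w , u) → IsCycle G (es ++ [ (w , u) ])
  closeCycle {u} {w} {es} s U notBack e =
    u , seq-++ s (cons e nil) , nonEmpty , distinct , subst Unique (sym (map-++ proj₁ es _)) sources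
    where
      sources : Unique (map proj₁ es ++ [ w ])
      sources = subst Unique (seq-visits s) U
      w∉ : w ∉ map proj₁ es
      w∉ m = proj₂ (proj₂ (Unique-++⁻ (map proj₁ es) sources)) m (here refl) refl
      nonEmpty : 1 ≤ length (es ++ [ (w , u) ])
      nonEmpty = subst (1 ≤_) (sym (length-++ es)) (ℕ.m≤n+m 1 (length es))
      distinct : AllPairs (DistinctEdge {G}) (es ++ [ (w , u) ])
      distinct = AllPairs.++⁺ (simple-distinct s U) ([] ∷ [])
        (All.tabulate (λ {f} m → ((λ eq → w∉ (subst (λ a → proj₁ a ∈ map proj₁ es) eq (∈-map⁺ proj₁ m))) ,
                                  (λ eq → notBack (subst (_∈ es) eq m))) ∷ []))

  closed-source→target : ∀ {OK w es x} → Seq G OK w w es → x ∈ map proj₁ es → x ∈ map proj₂ es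
  closed-source→target {w = w} {es} {x} s x∈ with subst (x ∈_) (sym (seq-visits s)) (∈-++⁺ˡ x∈)
  ... | there x∈′ = x∈′
  ... | here refl with s
  ... | cons o s′ = seq-target (cons o s′)

  closed-target→source : ∀ {OK w es x} → Seq G OK w w es → x ∈ map proj₂ es → x ∈ map proj₁ es
  closed-target→source {w = w} {es} {x} s x∈ with ∈-++⁻ (map proj₁ es) (subst (x ∈_) (seq-visits s) (there x∈))
  ... | inj₁ x∈′ = x∈′
  ... | inj₂ (here refl) with s
  ... | cons o s′ = here refl

  module _ {R : V G → Set} where

    reach-++ : ∀ {u v w} → ReachIn G R u v → ReachIn G R v w → ReachIn G R u w
    reach-++ here s = s
    reach-++ (step e m r) s = step e m (reach-++ r s)

    reach-reverse : ∀ {u w} → R u → ReachIn G R u w → ReachIn G R w u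
    reach-reverse u∈R here = here
    reach-reverse u∈R (step e m r) = reach-++ (reach-reverse m r) (step (edgeOrRev-flip e) u∈R here)

    reach-end : ∀ {u w} → ReachIn G R u w → u ≡ w ⊎ R w
    reach-end here = inj₁ refl
    reach-end (step e m r) with reach-end r
    ... | inj₁ refl = inj₂ m
    ... | inj₂ w∈R = inj₂ w∈R

    reach-lift : ∀ {Q : V G → Set} {x w} → ReachIn G R x w → (∀ v → ReachIn G R x v → Q v) → ReachIn G Q x w
    reach-lift here h = here
    reach-lift (step e m r) h = step e (h _ (step e m here)) (reach-lift r (λ v r′ → h v (step e m r′)))

    arcs : ∀ {u w} → ReachIn G R u w → List (Arc G)
    arcs here = []
    arcs {u} (step {v = v} e m r) = (u , v) ∷ arcs r

    seq-arcs : ∀ {u w} (r : ReachIn G R u w) → Seq G (IsEdgeOrRev G) u w (arcs r)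
    seq-arcs here = nil
    seq-arcs (step e m r) = cons e (seq-arcs r)

    arcs-targets : ∀ {u w q} (r : ReachIn G R u w) → q ∈ map proj₂ (arcs r) → R q
    arcs-targets (step e m r) (here refl) = m
    arcs-targets (step e m r) (there q∈) = arcs-targets r q∈

    seq→reach : ∀ {u w es} → Seq G (IsEdgeOrRev G) u w es → (∀ {q} → q ∈ map proj₂ es → R q) → ReachIn G R u w
    seq→reach nil inR = here
    seq→reach (cons e s) inR = step e (inR (here refl)) (seq→reach s (λ m → inR (there m)))

    shortcut : ∀ {u w x} (r : ReachIn G R u w) → x ∈ visits u (arcs r) →
               Σ (ReachIn G R x w) λ r′ → Unique (visits u (arcs r)) → Unique (visits x (arcs r′))
    shortcut here (here refl) = here , λ U → U
    shortcut (step e m r) (here refl) = step e m r , λ U → U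
    shortcut (step e m r) (there x∈) with shortcut r x∈
    ... | r′ , f = r′ , λ { (_ ∷ U) → f U }

    simplify : ∀ {u w} → ReachIn G R u w → Σ (ReachIn G R u w) λ r → Unique (visits u (arcs r))
    simplify here = here , [] ∷ []
    simplify {u} (step e m r) with simplify r
    ... | r′ , U with any? (u Fin.≟_) (visits _ (arcs r′))
    ... | yes u∈ = proj₁ (shortcut r′ u∈) , proj₂ (shortcut r′ u∈) U
    ... | no u∉ = step e m r′ , Unique-∷ u∉ U

  reach-map : ∀ {R R′ : V G → Set} → (∀ {x} → R x → R′ x) → ∀ {u w} → ReachIn G R u w → ReachIn G R′ u w
  reach-map f here = here
  reach-map f (step e m r) = step e (f m) (reach-map f r)

  -- Reachability inside a decidable vertex set is decidable: it suffices
  -- to search the walks of length at most n G.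
  reach? : ∀ {R : V G → Set} → (∀ v → Dec (R v)) → ∀ u w → Dec (ReachIn G R u w)
  reach? {R} R? u w = map′ fromWalk toWalk
    (searchLists searchArc (n G) (λ es → seq? edgeOrRev? u w es ×-dec All.all? R? (map proj₂ es)))
    where
      fromWalk : (∃ λ es → length es ≤ n G × Seq G (IsEdgeOrRev G) u w es × All R (map proj₂ es)) → ReachIn G R u w
      fromWalk (es , _ , s , inR) = seq→reach s (All.lookup inR)
      toWalk : ReachIn G R u w → ∃ λ es → length es ≤ n G × Seq G (IsEdgeOrRev G) u w es × All R (map proj₂ es)
      toWalk r with simplify r
      ... | r′ , U = arcs r′ , short , seq-arcs r′ , All.tabulate (arcs-targets r′)
        where
          short : length (arcs r′) ≤ n G
          short = ℕ.≤-trans (ℕ.n≤1+n _) (subst (λ k → suc k ≤ n G) (length-map proj₂ (arcs r′)) (Unique-bound _ U))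

  -- Whether the subgraph induced on a decidable vertex set contains a cycle
  -- is decidable: a cycle visits distinct vertices, so has at most n G arcs.
  cycleIn? : ∀ {R : V G → Set} → (∀ v → Dec (R v)) → Dec (∃ λ C → IsCycleIn G R C)
  cycleIn? {R} R? = map′ (λ { (C , _ , cyc) → C , cyc }) (λ { (C , cyc) → C , short cyc , cyc })
                         (searchLists searchArc (n G) isCycleIn?)
    where
      distinct? : ∀ e f → Dec (DistinctEdge {G} e f)
      distinct? e f = ¬? (e ≟ₐ f) ×-dec ¬? (e ≟ₐ flip {G} f)
      isCycleIn? : ∀ C → Dec (IsCycleIn G R C)
      isCycleIn? C =
        searchVertex (λ u → seq? edgeOrRev? u u C ×-dec length C ≥? 1 ×-dec allPairs? distinct? C
                             ×-dec allPairs? (λ x y → ¬? (x Fin.≟ y)) (map proj₁ C))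
        ×-dec map′ (λ a e → All.lookup a) (λ f → All.tabulate (f _)) (All.all? (λ e → R? (proj₁ e) ×-dec R? (proj₂ e)) C)
      short : ∀ {C} → IsCycleIn G R C → length C ≤ n G
      short {C} ((_ , _ , _ , _ , U) , _) = subst (_≤ n G) (length-map proj₁ C) (Unique-bound _ U)

  module _ (noCircuit : NoCircuit G) where

    no-loop : ∀ {u} → IsEdgeOrRev G (u , u) → ⊥
    no-loop {u} (inj₁ e) = noCircuit ((u , u) ∷ []) (u , cons e nil , s≤s z≤n , [] ∷ [] , [] ∷ [])
    no-loop {u} (inj₂ e) = noCircuit ((u , u) ∷ []) (u , cons e nil , s≤s z≤n , [] ∷ [] , [] ∷ [])

    no-digon : ∀ {u v} → IsEdge G (u , v) → IsEdge G (v , u) → ⊥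
    no-digon {u} {v} e₁ e₂ with u Fin.≟ v
    ... | yes refl = no-loop (inj₁ e₁)
    ... | no u≢v = noCircuit ((u , v) ∷ (v , u) ∷ [])
          (u , cons e₁ (cons e₂ nil) , s≤s z≤n , ((λ eq → u≢v (cong proj₁ eq)) ∷ []) ∷ [] ∷ [] , (u≢v ∷ []) ∷ [] ∷ [])

-- Chains.

module Chains (G : Graph) where
  open GraphFacts G

  chainVertices-visits : ∀ {OK u w es x} → Seq G OK u w es → x ∈ chainVertices {G} es → x ∈ visits u es
  chainVertices-visits (cons _ _) x∈ = x∈

  visits-chainVertices : ∀ {OK u w es x e} → Seq G OK u w es → e ∈ es → x ∈ visits u es → x ∈ chainVertices {G} es
  visits-chainVertices (cons _ _) _ x∈ = x∈

  visits-unique : ∀ {OK u w es} → Seq G OK u w es → Unique (chainVertices {G} es) → Unique (visits u es)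
  visits-unique nil _ = [] ∷ []
  visits-unique (cons _ _) U = U

  arc-adjacent : ∀ {OK u w a b} es → Seq G OK u w es → (a , b) ∈ es → Adjacent (visits u es) a b
  arc-adjacent {u = u} {a = a} {b = b} es s m with ∈-∃++ m
  ... | es₁ , es₂ , refl with seq-split es₁ s
  ... | _ , s₁ , cons _ _ = map proj₁ es₁ , map proj₂ es₂ , (begin
    u ∷ map proj₂ (es₁ ++ (a , b) ∷ es₂)        ≡⟨ cong (u ∷_) (map-++ proj₂ es₁ _) ⟩
    visits u es₁ ++ b ∷ map proj₂ es₂           ≡⟨ cong (_++ _) (seq-visits s₁) ⟩
    (map proj₁ es₁ ++ [ a ]) ++ b ∷ map proj₂ es₂ ≡⟨ ++-assoc (map proj₁ es₁) _ _ ⟩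
    map proj₁ es₁ ++ a ∷ b ∷ map proj₂ es₂      ∎)
    where open ≡-Reasoning

  Segment : List (Arc G) → V G → V G → List (Arc G) → Set
  Segment c a b seg = Seq G (IsEdge G) a b seg × (∀ {e} → e ∈ seg → e ∈ c) × Unique (visits a seg)

  segment : ∀ {u w c x y} → Seq G (IsEdge G) u w c → Unique (visits u c) →
            x ∈ visits u c → y ∈ visits u c → ∃ λ seg → Segment c x y seg ⊎ Segment c y x seg
  segment {u} {c = c} {y = y} s U x∈ y∈ with seq-cut s x∈
  ... | as , bs , refl , s₁ , s₂ with ∈-++⁻ (visits u as) (subst (y ∈_) (cong (u ∷_) (map-++ proj₂ as bs)) y∈)
  ... | inj₁ y∈as with seq-cut s₁ y∈as
  ...   | as₁ , as₂ , refl , t₁ , t₂ =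
          as₂ , inj₂ (t₂ , (λ m → ∈-++⁺ˡ (∈-++⁺ʳ as₁ m)) , unique-suffix as₁ t₁ t₂ (unique-prefix {OK = IsEdge G} (as₁ ++ as₂) U))
  segment {u} {c = c} {y = y} s U x∈ y∈ | as , bs , refl , s₁ , s₂ | inj₂ y∈bs with seq-cut s₂ (there y∈bs)
  ...   | bs₁ , bs₂ , refl , t₁ , t₂ =
          bs₁ , inj₁ (t₁ , (λ m → ∈-++⁺ʳ as (∈-++⁺ˡ m)) , unique-prefix {OK = IsEdge G} bs₁ (unique-suffix as s₁ s₂ U))

  module _ (noCircuit : NoCircuit G) (noTransitivity : NoTransitivityEdge G) where

    edge-adjacent : ∀ {u w c a b} → Seq G (IsEdge G) u w c → Unique (visits u c) →
                    a ∈ visits u c → b ∈ visits u c → IsEdge G (a , b) → Adjacent (visits u c) a b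
    edge-adjacent {a = a} {b} s U a∈ b∈ e with a Fin.≟ b
    ... | yes refl = ⊥-elim (no-loop noCircuit (inj₁ e))
    ... | no a≢b with segment s U a∈ b∈
    ... | _ , inj₁ (nil , _) = ⊥-elim (a≢b refl)
    ... | _ , inj₁ (cons _ nil , inC , _) = arc-adjacent _ s (inC (here refl))
    ... | seg , inj₁ (t@(cons _ (cons _ _)) , _ , Useg) =
          ⊥-elim (noTransitivity a b e (seg , (t , AllPairs-map proj₁ (simple-distinct t Useg) , Useg) , s≤s (s≤s z≤n)))
    ... | seg , inj₂ (t , _ , Useg) =
          ⊥-elim (noCircuit ((a , b) ∷ seg) (a , cons e t , s≤s z≤n ,
                   Unique-∷ (λ m → a∉ (∈-map⁺ proj₁ m)) (AllPairs-map proj₁ (simple-distinct t Useg)) ,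
                   Unique-∷ a∉ sources))
      where
        sources-a : Unique (map proj₁ seg ++ [ a ])
        sources-a = subst Unique (seq-visits t) Useg
        sources : Unique (map proj₁ seg)
        sources = proj₁ (Unique-++⁻ (map proj₁ seg) sources-a)
        a∉ : a ∉ map proj₁ seg
        a∉ m = proj₂ (proj₂ (Unique-++⁻ (map proj₁ seg) sources-a)) m (here refl) refl

    edge-neighbours : ∀ {u w c a b} → Seq G (IsEdge G) u w c → Unique (visits u c) →
                      a ∈ visits u c → b ∈ visits u c → IsEdgeOrRev G (a , b) → Neighbours (visits u c) a b
    edge-neighbours s U a∈ b∈ (inj₁ e) = inj₁ (edge-adjacent s U a∈ b∈ e)
    edge-neighbours s U a∈ b∈ (inj₂ e) = inj₂ (edge-adjacent s U b∈ a∈ e)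

module RegionOfComponent
  (G : Graph) (noCircuit : NoCircuit G) (noTransitivity : NoTransitivityEdge G) (connected : Connected G)
  (c : List (Arc G)) {u₀ w₀ : V G} (chain : Seq G (IsEdge G) u₀ w₀ c) (chainUnique : Unique (chainVertices {G} c))
  (K : V G → Set) (component : IsComponent G (NotVc G c) K)
  where

  open GraphFacts G
  open Chains G

  Rg : V G → Set
  Rg = Region G c K

  K∌Vc : ∀ {x} → K x → Vc G c x → ⊥
  K∌Vc = proj₁ component

  k₀ : V G
  k₀ = proj₁ (proj₁ (proj₂ component))

  k₀∈K : K k₀
  k₀∈K = proj₂ (proj₁ (proj₂ component))

  K-connected : ConnectedOn G K
  K-connected = proj₁ (proj₂ (proj₂ component))

  path : List (V G)
  path = visits u₀ c

  path-unique : Unique path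
  path-unique = visits-unique chain chainUnique

  arc-in-chain : ∀ {p q} → (p , q) ∈ c → Vc G c p × Vc G c q
  arc-in-chain m with seq-endpoints chain m
  ... | p∈ , q∈ = visits-chainVertices chain m p∈ , visits-chainVertices chain m (there q∈)

  Vc? : ∀ x → Dec (Vc G c x)
  Vc? x = any? (x Fin.≟_) (chainVertices {G} c)

  -- By maximality of the component, every vertex reachable from k₀ outside
  -- the chain lies in K.
  K-reach : ∀ {w} → ReachIn G (NotVc G c) k₀ w → K w
  K-reach = proj₂ (proj₂ (proj₂ component)) Reachable reachable-outside K⊆Reachable reachable-connected
    where
      Reachable : V G → Set
      Reachable = ReachIn G (NotVc G c) k₀
      reachable-outside : ∀ {x} → Reachable x → NotVc G c x
      reachable-outside r with reach-end r
      ... | inj₁ refl = K∌Vc k₀∈K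
      ... | inj₂ x∉ = x∉
      K⊆Reachable : ∀ {x} → K x → Reachable x
      K⊆Reachable {x} x∈K = reach-map K∌Vc (K-connected k₀ x k₀∈K x∈K)
      lift : ∀ {w} → Reachable w → ReachIn G Reachable k₀ w
      lift r = reach-lift r (λ v r′ → r′)
      reachable-connected : ConnectedOn G Reachable
      reachable-connected a b ra rb = reach-++ (reach-reverse {R = Reachable} here (lift ra)) (lift rb)

  K? : ∀ x → Dec (K x)
  K? x = map′ K-reach (λ x∈K → reach-map K∌Vc (K-connected k₀ x k₀∈K x∈K)) (reach? (λ v → ¬? (Vc? v)) k₀ x)

  Rg? : ∀ x → Dec (Rg x)
  Rg? x = K? x ⊎-dec Vc? x

  segment-targets : ∀ {seg q} → (∀ {e} → e ∈ seg → e ∈ c) → q ∈ map proj₂ seg → Vc G c q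
  segment-targets inC q∈ with ∈-map⁻ proj₂ q∈
  ... | _ , e∈ , refl = proj₂ (arc-in-chain (inC e∈))

  along-chain : ∀ {x y} → Vc G c x → Vc G c y → ReachIn G Rg x y
  along-chain x∈ y∈ with segment chain path-unique (chainVertices-visits chain x∈) (chainVertices-visits chain y∈)
  ... | _ , inj₁ (s , inC , _) = seq→reach (seq-map inj₁ s) (inj₂ ∘ segment-targets inC)
  ... | _ , inj₂ (s , inC , _) = reach-reverse (inj₂ y∈) (seq→reach (seq-map inj₁ s) (inj₂ ∘ segment-targets inC))

  walk-to-chain : ∀ {s t} → ReachIn G (NotVc G c) k₀ s → ReachIn G (λ _ → ⊤) s t → Vc G c t →
                  ∃ λ z → Vc G c z × ReachIn G Rg s z
  walk-to-chain _ here t∈ = _ , t∈ , here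
  walk-to-chain k₀⇝s (step {v = v} e _ r) t∈ with Vc? v
  ... | yes v∈ = v , v∈ , step e (inj₂ v∈) here
  ... | no v∉ with walk-to-chain (reach-++ k₀⇝s (step e v∉ here)) r t∈
  ... | z , z∈ , v⇝z = z , z∈ , step e (inj₁ (K-reach (reach-++ k₀⇝s (step e v∉ here)))) v⇝z

  from-k₀ : ∀ x → Rg x → ReachIn G Rg k₀ x
  from-k₀ x (inj₁ x∈K) = reach-map inj₁ (K-connected k₀ x k₀∈K x∈K)
  from-k₀ x (inj₂ x∈) with walk-to-chain here (connected k₀ x tt tt) x∈
  ... | z , z∈ , k₀⇝z = reach-++ k₀⇝z (along-chain z∈ x∈)

  region-connected : ConnectedOn G Rg
  region-connected x y x∈ y∈ = reach-++ (reach-reverse (inj₁ k₀∈K) (from-k₀ x x∈)) (from-k₀ y y∈)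

  Attached : V G → Set
  Attached x = Vc G c x × ∃ λ k → K k × IsEdgeOrRev G (x , k)

  GoodCycle : Set
  GoodCycle = ∃ λ C → IsCycleIn G Rg C × HEAvoids G C c

  -- Two distinct attached vertices a, b close a good cycle: from b back
  -- along the chain to a, over to K, through K, and back to b.  Its only
  -- arcs between chain vertices are traversed against their direction.
  attached-cycle : ∀ {a b seg} → Segment c a b seg → a ≢ b → Attached a → Attached b → GoodCycle
  attached-cycle {a} {b} {seg} (s , inC , U) a≢b (a∈ , ka , ka∈K , ea) (b∈ , kb , kb∈K , eb) =
    P ++ [ (kb , b) ] , (closeCycle walk walk-unique kb∉P (edgeOrRev-flip eb) , inRegion) , avoids
    where
      inK : Σ (ReachIn G K ka kb) λ r → Unique (visits ka (arcs r))
      inK = simplify (K-connected ka kb ka∈K kb∈K)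
      r = proj₁ inK

      P : List (Arc G)
      P = reversePath seg ++ (a , ka) ∷ arcs r

      walk : Seq G (IsEdgeOrRev G) b kb P
      walk = seq-++ (seq-reversePath s) (cons ea (seq-arcs r))

      ArcKind : Arc G → Set
      ArcKind f = flip {G} f ∈ seg ⊎ f ≡ (a , ka) ⊎ K (proj₁ f) × K (proj₂ f)

      in-K : ∀ {x} → x ∈ visits ka (arcs r) → K x
      in-K (here refl) = ka∈K
      in-K (there x∈) = arcs-targets r x∈

      kind : ∀ {f} → f ∈ P → ArcKind f
      kind f∈ with ∈-++⁻ (reversePath seg) f∈
      ... | inj₁ f∈seg = inj₁ (reversePath-∈ seg f∈seg)
      ... | inj₂ (here refl) = inj₂ (inj₁ refl)
      ... | inj₂ (there f∈r) with seq-endpoints (seq-arcs r) f∈r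
      ... | p∈ , q∈ = inj₂ (inj₂ (in-K p∈ , arcs-targets r q∈))

      backwards-Vc : ∀ {f} → flip {G} f ∈ seg → Vc G c (proj₁ f) × Vc G c (proj₂ f)
      backwards-Vc f∈ = let p∈ , q∈ = arc-in-chain (inC f∈) in q∈ , p∈

      chainPart : List (V G)
      chainPart = b ∷ reverse (map proj₁ seg)

      chainPart-reverse : reverse (visits a seg) ≡ chainPart
      chainPart-reverse = trans (cong reverse (seq-visits s)) (reverse-++ (map proj₁ seg) [ b ])

      chainPart-Vc : ∀ {x} → x ∈ chainPart → Vc G c x
      chainPart-Vc {x} x∈ with Any.reverse⁻ {xs = visits a seg} (subst (x ∈_) (sym chainPart-reverse) x∈)
      ... | here refl = a∈
      ... | there x∈′ = segment-targets inC x∈′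

      walk-unique : Unique (visits b P)
      walk-unique = subst Unique (sym visits-split)
        (Unique-++⁺ (subst Unique chainPart-reverse (Unique-reverse _ U)) (proj₂ inK)
                    (λ x∈ x∈′ → K∌Vc (in-K x∈′) (chainPart-Vc x∈)))
        where
          visits-split : visits b P ≡ chainPart ++ visits ka (arcs r)
          visits-split = cong (b ∷_) (trans (map-++ proj₂ (reversePath seg) _) (cong (_++ visits ka (arcs r)) (reversePath-targets seg)))

      kb∉P : (b , kb) ∉ P
      kb∉P m with kind m
      ... | inj₁ f∈ = K∌Vc kb∈K (proj₂ (backwards-Vc f∈))
      ... | inj₂ (inj₁ refl) = a≢b refl
      ... | inj₂ (inj₂ (b∈K , _)) = K∌Vc b∈K b∈

      inRegion : ∀ e → e ∈ P ++ [ (kb , b) ] → Rg (proj₁ e) × Rg (proj₂ e)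
      inRegion e m with ∈-++⁻ P m
      ... | inj₂ (here refl) = inj₁ kb∈K , inj₂ b∈
      ... | inj₁ e∈ with kind e∈
      ... | inj₁ f∈ = let p∈ , q∈ = backwards-Vc f∈ in inj₂ p∈ , inj₂ q∈
      ... | inj₂ (inj₁ refl) = inj₂ a∈ , inj₁ ka∈K
      ... | inj₂ (inj₂ (p∈K , q∈K)) = inj₁ p∈K , inj₁ q∈K

      avoids : HEAvoids G (P ++ [ (kb , b) ]) c
      avoids e m e-edge e∈c with arc-in-chain e∈c | ∈-++⁻ P m
      ... | p∈ , _ | inj₂ (here refl) = K∌Vc kb∈K p∈
      ... | p∈ , q∈ | inj₁ e∈ with kind e∈
      ... | inj₁ f∈ = no-digon noCircuit e-edge (seq-arc s f∈)
      ... | inj₂ (inj₁ refl) = K∌Vc ka∈K q∈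
      ... | inj₂ (inj₂ (p∈K , _)) = K∌Vc p∈K p∈

  AttachedPair : Set
  AttachedPair = ∃₂ λ x y → x ≢ y × Attached x × Attached y

  attached-pair-cycle : AttachedPair → GoodCycle
  attached-pair-cycle (x , y , x≢y , x-att , y-att)
    with segment chain path-unique (chainVertices-visits chain (proj₁ x-att)) (chainVertices-visits chain (proj₁ y-att))
  ... | _ , inj₁ seg = attached-cycle seg x≢y x-att y-att
  ... | _ , inj₂ seg = attached-cycle seg (x≢y ∘ sym) y-att x-att

  module CycleThroughChain {w C} (closed : Seq G (IsEdgeOrRev G) w w C) (distinct : AllPairs (DistinctEdge {G}) C)
                           (inRegion : ∀ e → e ∈ C → Rg (proj₁ e) × Rg (proj₂ e)) where

    OnC : V G → Set
    OnC x = x ∈ map proj₁ C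

    cycle-neighbours : ∀ {y} → OnC y → ∃₂ λ p s → (p , y) ∈ C × (y , s) ∈ C × p ≢ s
    cycle-neighbours {y} y-on with ∈-map⁻ proj₁ y-on | ∈-map⁻ proj₂ (closed-source→target closed y-on)
    ... | (_ , s) , s∈ , refl | (p , _) , p∈ , refl = p , s , p∈ , s∈ , p≢s
      where
        p≢s : p ≢ s
        p≢s refl with y Fin.≟ p
        ... | yes refl = no-loop noCircuit (seq-arc closed s∈)
        ... | no y≢p with AllPairs-either distinct p∈ s∈ (λ eq → y≢p (cong proj₂ eq))
        ... | inj₁ (_ , d) = d refl
        ... | inj₂ (_ , d) = d refl

    leaves-run : ∀ {L from} → Unique L →
                 (∀ {a b} → a ∈ L → b ∈ L → IsEdgeOrRev G (a , b) → Neighbours L a b) →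
                 (∀ {x} → Vc G c x → x ∈ L) →
                 (run : RunEnd OnC L from) → ∃ λ k → K k × IsEdgeOrRev G (RunEnd.last run , k)
    leaves-run {L} UL neighbours Vc⊆L run with cycle-neighbours (RunEnd.inRun run)
    ... | p , s , p∈ , s∈ , p≢s with proj₂ (inRegion _ s∈) | proj₁ (inRegion _ p∈)
    ... | inj₁ s∈K | _ = s , s∈K , seq-arc closed s∈
    ... | inj₂ _ | inj₁ p∈K = p , p∈K , edgeOrRev-flip (seq-arc closed p∈)
    ... | inj₂ s∈Vc | inj₂ p∈Vc with previous s∈Vc (closed-target→source closed (∈-map⁺ proj₂ s∈)) (seq-arc closed s∈)
                                   | previous p∈Vc (∈-map⁺ proj₁ p∈) (edgeOrRev-flip (seq-arc closed p∈))
      where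
        open RunEnd run
        previous : ∀ {r} → Vc G c r → OnC r → IsEdgeOrRev G (last , r) → ∃ λ as → before ≡ as ++ [ r ]
        previous r∈ r-on e
          with neighbour-position before after UL split (neighbours (subst (last ∈_) (sym split) (∈-++⁺ʳ before (here refl))) (Vc⊆L r∈) e)
        ... | inj₁ prev = prev
        ... | inj₂ (_ , eq) = ⊥-elim (stops eq r-on)
    ... | as , before≡s | as′ , before≡p = ⊥-elim (p≢s (sym (proj₂ (∷ʳ-injective as as′ (trans (sym before≡s) before≡p)))))

    -- A chain arc on the cycle yields two distinct attached vertices: the
    -- ends of the run of cycle vertices around it along the chain.
    chain-arc-pair : ∀ {p q} → (p , q) ∈ c → OnC p → OnC q → AttachedPair
    chain-arc-pair {p} {q} pq∈c p-on q-on with arc-adjacent c chain pq∈c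
    ... | pre , suf , path≡ = x , y , x≢y , (x∈Vc , leaves-run (Unique-reverse path path-unique) reverse-neighbours
                                                      (Any.reverse⁺ ∘ chainVertices-visits chain) backward)
                                         , (y∈Vc , leaves-run path-unique path-neighbours (chainVertices-visits chain) forward)
      where
        path≡′ : path ≡ (pre ++ [ p ]) ++ q ∷ suf
        path≡′ = trans path≡ (sym (++-assoc pre [ p ] (q ∷ suf)))
        forward : RunEnd OnC path (q ∷ suf)
        forward = runEnd (λ v → any? (v Fin.≟_) (map proj₁ C)) (pre ++ [ p ]) q suf path≡′ q-on
        backward : RunEnd OnC (reverse path) (p ∷ reverse pre)
        backward = runEnd (λ v → any? (v Fin.≟_) (map proj₁ C)) (reverse suf ++ [ q ]) p (reverse pre)
                          (trans (cong reverse path≡) (reverse-adjacent pre p q suf)) p-on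
        x y : V G
        x = RunEnd.last backward
        y = RunEnd.last forward
        path-neighbours : ∀ {a b} → a ∈ path → b ∈ path → IsEdgeOrRev G (a , b) → Neighbours path a b
        path-neighbours = edge-neighbours noCircuit noTransitivity chain path-unique
        reverse-neighbours : ∀ {a b} → a ∈ reverse path → b ∈ reverse path → IsEdgeOrRev G (a , b) → Neighbours (reverse path) a b
        reverse-neighbours a∈ b∈ e = Neighbours-reverse (path-neighbours (Any.reverse⁻ a∈) (Any.reverse⁻ b∈) e)
        x∈ : x ∈ pre ++ [ p ]
        x∈ with RunEnd.within backward
        ... | here eq = ∈-++⁺ʳ pre (here eq)
        ... | there x∈pre = ∈-++⁺ˡ (Any.reverse⁻ {xs = pre} x∈pre)
        y∈ : y ∈ q ∷ suf
        y∈ = RunEnd.within forward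
        x≢y : x ≢ y
        x≢y = proj₂ (proj₂ (Unique-++⁻ (pre ++ [ p ]) (subst Unique path≡′ path-unique))) x∈ y∈
        x∈Vc : Vc G c x
        x∈Vc = visits-chainVertices chain pq∈c (subst (x ∈_) (sym path≡′) (∈-++⁺ˡ x∈))
        y∈Vc : Vc G c y
        y∈Vc = visits-chainVertices chain pq∈c (subst (y ∈_) (sym path≡′) (∈-++⁺ʳ (pre ++ [ p ]) y∈))

  good-from-cycle : (∃ λ C → IsCycleIn G Rg C) → GoodCycle
  good-from-cycle (C , cyc) with any? (λ e → any? (e ≟ₐ_) c) C
  ... | no none = C , cyc , λ e e∈C _ e∈c → none (lose e∈C e∈c)
  ... | yes some with find some | cyc
  ... | (p , q) , pq∈C , pq∈c | (_ , closed , _ , distinct , _) , inRegion =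
        attached-pair-cycle (CycleThroughChain.chain-arc-pair closed distinct inRegion pq∈c
                              (∈-map⁺ proj₁ pq∈C) (closed-target→source closed (∈-map⁺ proj₂ pq∈C)))

  -- If the region is not a tree it contains a cycle, since it is connected
  -- and having a cycle is decidable; that cycle yields a good one.
  good-cycle : ¬ IsTreeOn G Rg → GoodCycle
  good-cycle notTree with cycleIn? Rg?
  ... | yes cyc = good-from-cycle cyc
  ... | no acyclic = ⊥-elim (notTree (region-connected , acyclic))

mainTheorem9 : (G : Graph) → Connected G → NoCircuit G → NoTransitivityEdge G
    → (c : List (Arc G)) → IsChain G c
    → (K : _) → IsComponent G (NotVc G c) K
    → ¬ IsTreeOn G (Region G c K)
    → ∃ λ C → IsCycleIn G (Region G c K) C × HEAvoids G C c
mainTheorem9 G connected noCircuit noTransitivity c (_ , _ , chain , _ , chainUnique) K component =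
  RegionOfComponent.good-cycle G noCircuit noTransitivity connected c chain chainUnique K component
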